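{- Let $T,S\subseteq\mathbb{Z}_{>0}$ be finite. Then $|T\triangleleft S|=|S|$ if and only if $T\preceq S$.
   Context: For finite $T,S\subseteq\mathbb{Z}_{>0}$, $T\triangleleft S$ is computed by going through $s\in S$ from largest to smallest; each $s$ picks the largest not-yet-picked $t\in T$ with $t<s$, if one exists; $T\triangleleft S$ is the set of picked elements. $S(i)$ denotes the $i$-th smallest element of $S$. $T\preceq S$ ($S$ dominates $T$) means $|T|\ge|S|$ and $T(i)<S(i)$ for all $i\in[|S|]$. -}

module Defs where

open import Data.Nat using (ℕ; zero; suc; _<_; _≤_; _≥_; _<?_)
open import Data.List using (List; []; _∷_; length; reverse; lookup)
open import Data.List.Relation.Unary.All using (All)
open import Data.List.Relation.Unary.Linked using (Linked)
open import Data.Maybe using (Maybe; just; nothing)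
open import Data.Product using (_×_; _,_; Σ)
open import Data.Fin using (Fin; inject≤)
open import Relation.Nullary using (yes; no)

-- A finite set of positive integers, represented by the list of its
-- elements in strictly increasing order (so S(i) = lookup S i, 0-indexed).
record FinPosSet : Set where
  constructor mkSet
  field
    elems    : List ℕ
    sorted   : Linked _<_ elems
    positive : All (0 <_) elems
open FinPosSet public

∣_∣ : FinPosSet → ℕ
∣ S ∣ = length (elems S)

_⟨_⟩ : (S : FinPosSet) → Fin ∣ S ∣ → ℕ
S ⟨ i ⟩ = lookup (elems S) i

-- Given s and the not-yet-picked elements (an increasing list), pick the
-- largest t with t < s (if any); return it and the remaining elements.
pick : ℕ → List ℕ → Maybe (ℕ × List ℕ)
pick s [] = nothing
pick s (t ∷ ts) with t <? s
... | no _ = nothing            -- list increasing: nothing further is < s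
... | yes _ with pick s ts
...   | just (u , rest) = just (u , t ∷ rest)
...   | nothing         = just (t , ts)

pickAll : List ℕ → List ℕ → List ℕ
pickAll []       pool = []
pickAll (s ∷ ss) pool with pick s pool
... | just (t , rest) = t ∷ pickAll ss rest
... | nothing         = pickAll ss pool

◁-elems : FinPosSet → FinPosSet → List ℕ
◁-elems T S = pickAll (reverse (elems S)) (elems T)

∣_◁_∣ : FinPosSet → FinPosSet → ℕ
∣ T ◁ S ∣ = length (◁-elems T S)

_⪯_ : FinPosSet → FinPosSet → Set
T ⪯ S = Σ (∣ S ∣ ≤ ∣ T ∣) λ le → (i : Fin ∣ S ∣) → T ⟨ inject≤ i le ⟩ < S ⟨ i ⟩

-- Let s be the largest element of S and S' = S ∖ {s}.  Then T ⪯ S holds iff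
-- T has an element below s and T ∖ {t} ⪯ S', where t is the largest such
-- element (the one s picks): giving s anything smaller than t only makes the
-- rest of T larger.  Since ◁ processes S from the top, induction on S shows
-- that every s picks something exactly when T ⪯ S.
module Submission where

open import Defs
open import Data.Nat using (suc; _<_; _>_; _≤_; _<?_; z≤n; s≤s)
open import Data.Nat.Properties using (<-trans; 1+n≰n; suc-injective; ≤-trans; n≤1+n)
open import Data.List using ([]; _∷_; _∷ʳ_; length; reverse; lookup)
open import Data.List.Properties using (unfold-reverse; reverse-involutive; length-reverse)
open import Data.List.Relation.Unary.All as All using (All; []; _∷_)
open import Data.List.Relation.Unary.AllPairs using (AllPairs; []; _∷_)
open import Data.List.Relation.Unary.Any.Properties as Any using ()
open import Data.List.Relation.Unary.AllPairs.Properties as AllPairs using ()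
open import Data.List.Relation.Unary.Linked.Properties using (Linked⇒AllPairs)
open import Data.List.Relation.Binary.Prefix.Heterogeneous using (Prefix; []; _∷_)
open import Data.Maybe using (just; nothing)
open import Data.Product using (Σ; _,_)
open import Data.Fin using (zero; suc; inject≤)
open import Function using (flip; _∘_)
open import Function.Bundles using (_⇔_; mk⇔)
open import Function.Properties.Equivalence using () renaming (trans to ⇔-trans)
open import Relation.Binary.Core using (REL; Rel)
open import Relation.Unary using (Pred)
open import Relation.Binary.PropositionalEquality using (_≡_; _≢_; refl; sym; cong; subst; subst₂)
open import Relation.Nullary using (yes; no; contradiction)

All-reverse⁺ : ∀ {a p} {A : Set a} {P : Pred A p} {xs} → All P xs → All P (reverse xs)
All-reverse⁺ pxs = All.tabulate (All.lookup pxs ∘ Any.reverse⁻)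

AllPairs-reverse⁺ : ∀ {a r} {A : Set a} {R : Rel A r} {xs} → AllPairs R xs → AllPairs (flip R) (reverse xs)
AllPairs-reverse⁺ [] = []
AllPairs-reverse⁺ {R = R} {x ∷ xs} (Rx ∷ Rxs) =
  subst (AllPairs (flip R)) (sym (unfold-reverse x xs))
    (AllPairs.++⁺ (AllPairs-reverse⁺ Rxs) ([] ∷ []) (All.map (_∷ []) (All-reverse⁺ Rx)))

module _ {a b r} {A : Set a} {B : Set b} {R : REL A B r} where

  prefix⇒lookup : ∀ {as bs} → Prefix R as bs →
    Σ (length as ≤ length bs) λ le → ∀ i → R (lookup as i) (lookup bs (inject≤ i le))
  prefix⇒lookup []       = z≤n , λ ()
  prefix⇒lookup (r ∷ rs) with le , f ← prefix⇒lookup rs = s≤s le , λ { zero → r ; (suc i) → f i }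

  lookup⇒prefix : ∀ {as bs} →
    (Σ (length as ≤ length bs) λ le → ∀ i → R (lookup as i) (lookup bs (inject≤ i le))) → Prefix R as bs
  lookup⇒prefix {[]}            _            = []
  lookup⇒prefix {_ ∷ _} {_ ∷ _} (s≤s le , f) = f zero ∷ lookup⇒prefix (le , f ∘ suc)

pick-head< : ∀ {s t} ts → t < s → pick s (t ∷ ts) ≢ nothing
pick-head< {s} {t} ts t<s with t <? s
... | no t≮s = contradiction t<s t≮s
... | yes _ with pick s ts
...   | just _  = λ ()
...   | nothing = λ ()

snoc-prefix⇒pick≢nothing : ∀ {s ss ts} → All (_< s) ss → Prefix _>_ (ss ∷ʳ s) ts → pick s ts ≢ nothing
snoc-prefix⇒pick≢nothing []        (t<s ∷ _) = pick-head< _ t<s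
snoc-prefix⇒pick≢nothing (x<s ∷ _) (t<x ∷ _) = pick-head< _ (<-trans t<x x<s)

pick-snoc⁺ : ∀ {s ss t ts ts′} → All (_< s) ss → pick s ts ≡ just (t , ts′) →
  Prefix _>_ ss ts′ → Prefix _>_ (ss ∷ʳ s) ts
pick-snoc⁺ {ts = []} _ () _
pick-snoc⁺ {s} {ts = t₀ ∷ ts} ss<s eq p with t₀ <? s
pick-snoc⁺ _  () _ | no _
pick-snoc⁺ [] _  _ | yes t₀<s = t₀<s ∷ []
pick-snoc⁺ {s} {ts = _ ∷ ts} (x<s ∷ ss<s) eq p | yes _ with pick s ts in picked | eq | p
... | just _  | refl | t₀<x ∷ p′ = t₀<x ∷ pick-snoc⁺ ss<s picked p′
... | nothing | refl | t₁<x ∷ _  = contradiction picked (pick-head< _ (<-trans t₁<x x<s))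

pick-snoc⁻ : ∀ {s ss t ts ts′} → All (_< s) ss → pick s ts ≡ just (t , ts′) →
  Prefix _>_ (ss ∷ʳ s) ts → Prefix _>_ ss ts′
pick-snoc⁻ [] _ _ = []
pick-snoc⁻ {s} {ts = t₀ ∷ ts} (x<s ∷ ss<s) eq (t₀<x ∷ p) with t₀ <? s
... | no t₀≮s = contradiction (<-trans t₀<x x<s) t₀≮s
... | yes _ with pick s ts in picked | eq
...   | just _  | refl = t₀<x ∷ pick-snoc⁻ ss<s picked p
...   | nothing | _    = contradiction picked (snoc-prefix⇒pick≢nothing ss<s p)

length-pickAll≤ : ∀ rs ts → length (pickAll rs ts) ≤ length rs
length-pickAll≤ []       ts = z≤n
length-pickAll≤ (s ∷ rs) ts with pick s ts
... | just (_ , ts′) = s≤s (length-pickAll≤ rs ts′)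
... | nothing        = ≤-trans (length-pickAll≤ rs ts) (n≤1+n _)

pickAll-complete⇔prefix : ∀ {rs} ts → AllPairs _>_ rs →
  (length (pickAll rs ts) ≡ length rs) ⇔ Prefix _>_ (reverse rs) ts
pickAll-complete⇔prefix ts [] = mk⇔ (λ _ → []) (λ _ → refl)
pickAll-complete⇔prefix {s ∷ rs} ts (s>rs ∷ rs↓) rewrite unfold-reverse s rs with pick s ts in picked
... | just (_ , ts′) =
  ⇔-trans (mk⇔ suc-injective (cong suc))
    (⇔-trans (pickAll-complete⇔prefix ts′ rs↓) (mk⇔ (pick-snoc⁺ rs<s picked) (pick-snoc⁻ rs<s picked)))
  where
  rs<s : All (_< s) (reverse rs)
  rs<s = All-reverse⁺ s>rs
... | nothing =
  mk⇔ (λ complete → contradiction (subst (_≤ length rs) complete (length-pickAll≤ rs ts)) 1+n≰n)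
      (λ p → contradiction picked (snoc-prefix⇒pick≢nothing (All-reverse⁺ s>rs) p))

pickAll-reverse⇔prefix : ∀ {ss} ts → AllPairs _<_ ss →
  (length (pickAll (reverse ss) ts) ≡ length ss) ⇔ Prefix _>_ ss ts
pickAll-reverse⇔prefix {ss} ts ss↑ =
  subst₂ (λ n xs → (length (pickAll (reverse ss) ts) ≡ n) ⇔ Prefix _>_ xs ts)
    (length-reverse ss) (reverse-involutive ss) (pickAll-complete⇔prefix ts (AllPairs-reverse⁺ ss↑))

lemma4p7 : (T S : FinPosSet) → (∣ T ◁ S ∣ ≡ ∣ S ∣) ⇔ (T ⪯ S)
lemma4p7 T S =
  ⇔-trans (pickAll-reverse⇔prefix (elems T) (Linked⇒AllPairs <-trans (sorted S)))
          (mk⇔ prefix⇒lookup lookup⇒prefix)
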